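{- Let $w=w_1\cdots w_n\in \mathfrak{S}_n$, $i\in\{1,\dots,n\}$ and $1\leq k\leq n-1$. Then $w_i$ is a $k$-peak of $w$ if and only if both of the following hold: (1) if there is $s>i$ with $w_s>w_i$, then there is $j$ with $i<j\le s$ and $w_i-w_j\ge k$; (2) if there is $s<i$ with $w_s>w_i$, then there is $j$ with $s\le j<i$ and $w_i-w_j\ge k$.
   Context: Let $n\ge2$ and $\mathfrak S_n$ the permutations of $\{1,\dots,n\}$ in one-line notation $w=w_1\cdots w_n$. A section of $w$ is a consecutive segment $w_sw_{s+1}\cdots w_t$. A section $w_i\cdots w_j$ with $i<j$ is $k$-ascending if (1) $w_i=\min\{w_i,\dots,w_j\}$ and $w_j=\max\{w_i,\dots,w_j\}$; (2) $w_j-w_i\ge k$; (3) there are no $i\le s<t\le j$ with $w_s-w_t\ge k$. It is $k$-descending if (1) $w_i=\max\{w_i,\dots,w_j\}$ and $w_j=\min\{w_i,\dots,w_j\}$; (2) $w_i-w_j\ge k$; (3) there are no $i\le s<t\le j$ with $w_t-w_s\ge k$. A $k$-ascending (resp. $k$-descending) section is maximal if it is not contained in another $k$-ascending (resp. $k$-descending) section. $w_j$ is a $k$-peak of $w$ if it is the last entry of some maximal $k$-ascending section $w_i\cdots w_j$, or the first entry of some maximal $k$-descending section $w_j\cdots w_t$. -}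

module Defs where

open import Data.Nat using (ℕ; _≤_; _<_; _+_)
open import Data.Fin using (Fin; toℕ)
open import Data.Fin.Permutation using (Permutation′; _⟨$⟩ʳ_)
open import Data.Product using (_×_; ∃-syntax)
open import Relation.Nullary using (¬_)

-- A permutation w ∈ 𝔖ₙ; positions are Fin n (position p stands for p+1),
-- and the value w_{p+1} is  val w p + 1  (values shifted to {0,…,n-1};
-- all conditions below only use order and differences, so this is harmless).
val : ∀ {n} → Permutation′ n → Fin n → ℕ
val w p = toℕ (w ⟨$⟩ʳ p)

InSec : ∀ {n} → Fin n → Fin n → Fin n → Set
InSec i j s = toℕ i ≤ toℕ s × toℕ s ≤ toℕ j

KAsc : ∀ {n} → ℕ → Permutation′ n → Fin n → Fin n → Set
KAsc k w i j =
  (toℕ i < toℕ j) ×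
  ((∀ s → InSec i j s → val w i ≤ val w s) ×
   (∀ s → InSec i j s → val w s ≤ val w j)) ×
  (val w i + k ≤ val w j) ×
  (¬ (∃[ s ] ∃[ t ] (InSec i j s × InSec i j t × toℕ s < toℕ t × val w t + k ≤ val w s)))

KDesc : ∀ {n} → ℕ → Permutation′ n → Fin n → Fin n → Set
KDesc k w i j =
  (toℕ i < toℕ j) ×
  ((∀ s → InSec i j s → val w s ≤ val w i) ×
   (∀ s → InSec i j s → val w j ≤ val w s)) ×
  (val w j + k ≤ val w i) ×
  (¬ (∃[ s ] ∃[ t ] (InSec i j s × InSec i j t × toℕ s < toℕ t × val w s + k ≤ val w t)))

MaxKAsc : ∀ {n} → ℕ → Permutation′ n → Fin n → Fin n → Set
MaxKAsc k w i j =
  KAsc k w i j ×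
  (∀ i′ j′ → KAsc k w i′ j′ → toℕ i′ ≤ toℕ i → toℕ j ≤ toℕ j′ →
     (toℕ i′ ≡ℕ toℕ i) × (toℕ j′ ≡ℕ toℕ j))
  where open import Relation.Binary.PropositionalEquality renaming (_≡_ to _≡ℕ_)

MaxKDesc : ∀ {n} → ℕ → Permutation′ n → Fin n → Fin n → Set
MaxKDesc k w i j =
  KDesc k w i j ×
  (∀ i′ j′ → KDesc k w i′ j′ → toℕ i′ ≤ toℕ i → toℕ j ≤ toℕ j′ →
     (toℕ i′ ≡ℕ toℕ i) × (toℕ j′ ≡ℕ toℕ j))
  where open import Relation.Binary.PropositionalEquality renaming (_≡_ to _≡ℕ_)

IsKPeak : ∀ {n} → ℕ → Permutation′ n → Fin n → Set
IsKPeak k w j = (∃[ i ] MaxKAsc k w i j) ⊎′ (∃[ t ] MaxKDesc k w j t)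
  where open import Data.Sum renaming (_⊎_ to _⊎′_)

-- If w_i ends a maximal k-ascending section, the start of that section witnesses (2), and (1)
-- holds since otherwise the section would extend up to the first later entry exceeding w_i;
-- maximal k-descending sections starting at w_i are symmetric. Conversely, some entry lies at
-- least k below w_i: either the entry 1 does, or w_i ≤ k and (1) or (2) applied to the entry
-- k + 1 produces one. If such an entry lies to the left of w_i, the last one starts a
-- k-ascending section ending at w_i; the leftmost start of such a section gives one that is
-- maximal, since by (1) no k-ascending section containing w_i can end to its right. Otherwise,
-- symmetrically, the first such entry to the right ends a k-descending section starting at
-- w_i, and the rightmost end is maximal.
module Submission where

open import Defs
open import Data.Nat using (ℕ; _≤_; _<_; _+_; _≤?_; _<?_; z≤n)
open import Data.Nat.Properties
open import Data.Fin using (Fin; toℕ; fromℕ<)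
open import Data.Fin.Properties using (toℕ-injective; toℕ-fromℕ<; any?; all?)
open import Data.Fin.Induction using (<-wellFounded; >-wellFounded)
open import Data.Fin.Permutation using (Permutation′; _⟨$⟩ʳ_; _⟨$⟩ˡ_; inverseˡ; inverseʳ)
open import Data.Product using (_×_; _,_; proj₁; proj₂; ∃; ∃-syntax)
open import Data.Sum using (inj₁; inj₂)
open import Function using (_∘_)
open import Function.Bundles using (_⇔_; mk⇔)
open import Induction.WellFounded using (WellFounded; Acc; acc)
open import Relation.Binary using (Rel; tri<; tri≈; tri>)
  renaming (Decidable to Decidable₂)
open import Relation.Binary.PropositionalEquality
open import Relation.Nullary using (¬_; Dec; yes; no; contradiction)
open import Relation.Nullary.Decidable using (_×-dec_; _→-dec_; ¬?)
open import Relation.Unary using (Pred; Decidable)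

+-≤-<-cancelʳ : ∀ {m n o} p → m + p ≤ n → n < o + p → m < o
+-≤-<-cancelʳ {m} {n} {o} p m+p≤n n<o+p = +-cancelʳ-< p m o (≤-<-trans m+p≤n n<o+p)

module _ {n p} {P : Pred (Fin n) p} (P? : Decidable P) where

  minimal : ∀ {r} {_≺_ : Rel (Fin n) r} → WellFounded _≺_ → Decidable₂ _≺_ →
            ∃ P → ∃[ m ] (P m × ∀ u → P u → ¬ u ≺ m)
  minimal {_≺_ = _≺_} wf _≺?_ (x , px) = go x (wf x) px
    where
    go : ∀ x → Acc _≺_ x → P x → ∃[ m ] (P m × ∀ u → P u → ¬ u ≺ m)
    go x (acc below) px with any? (λ u → P? u ×-dec u ≺? x)
    ... | yes (u , pu , u≺x) = go u (below u≺x) pu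
    ... | no none = x , px , λ u pu u≺x → none (u , pu , u≺x)

  least : ∃ P → ∃[ m ] (P m × ∀ u → P u → toℕ m ≤ toℕ u)
  least ex with m , pm , m-min ← minimal <-wellFounded (λ u x → toℕ u <? toℕ x) ex =
    m , pm , λ u pu → ≮⇒≥ (m-min u pu)

  greatest : ∃ P → ∃[ m ] (P m × ∀ u → P u → toℕ u ≤ toℕ m)
  greatest ex with m , pm , m-max ← minimal >-wellFounded (λ u x → toℕ x <? toℕ u) ex =
    m , pm , λ u pu → ≮⇒≥ (m-max u pu)

module KPeaks {n : ℕ} (w : Permutation′ n) (k : ℕ) (1≤k : 1 ≤ k) where

  v : Fin n → ℕ
  v = val w

  _≪_ : Fin n → Fin n → Set
  j ≪ i = v j + k ≤ v i

  RightCondition LeftCondition : Fin n → Set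
  RightCondition i = ∀ s → toℕ i < toℕ s → v i < v s →
    ∃[ j ] (toℕ i < toℕ j × toℕ j ≤ toℕ s × j ≪ i)
  LeftCondition i = ∀ s → toℕ s < toℕ i → v i < v s →
    ∃[ j ] (toℕ s ≤ toℕ j × toℕ j < toℕ i × j ≪ i)

  val-injective : ∀ {p q} → v p ≡ v q → p ≡ q
  val-injective {p} {q} vp≡vq = begin
    p                           ≡⟨ inverseˡ w ⟨
    w ⟨$⟩ˡ (w ⟨$⟩ʳ p)           ≡⟨ cong (w ⟨$⟩ˡ_) (toℕ-injective vp≡vq) ⟩
    w ⟨$⟩ˡ (w ⟨$⟩ʳ q)           ≡⟨ inverseˡ w ⟩
    q                           ∎
    where open ≡-Reasoning

  val-≤-antisym : ∀ {p q} → toℕ p ≤ toℕ q → toℕ q ≤ toℕ p → v p ≡ v q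
  val-≤-antisym p≤q q≤p = cong v (toℕ-injective (≤-antisym p≤q q≤p))

  val-≤∧≢⇒< : ∀ {p q} → toℕ p ≢ toℕ q → v p ≤ v q → v p < v q
  val-≤∧≢⇒< p≢q vp≤vq = ≤∧≢⇒< vp≤vq (p≢q ∘ cong toℕ ∘ val-injective)

  ≪-irreflexive : ∀ {i} → ¬ (i ≪ i)
  ≪-irreflexive {i} = <⇒≱ (m<m+n (v i) 1≤k)

  position-of : ∀ m → m < n → Fin n
  position-of m m<n = w ⟨$⟩ˡ fromℕ< m<n

  val-position-of : ∀ m (m<n : m < n) → v (position-of m m<n) ≡ m
  val-position-of m m<n = trans (cong toℕ (inverseʳ w)) (toℕ-fromℕ< m<n)

  asc⇒left : ∀ {a i} → KAsc k w a i → LeftCondition i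
  asc⇒left {a} (a<i , (_ , i-max) , a≪i , _) s s<i vi<vs = a , s≤a , a<i , a≪i
    where
    s≤a : toℕ s ≤ toℕ a
    s≤a = ≮⇒≥ λ a<s → <⇒≱ vi<vs (i-max s (<⇒≤ a<s , <⇒≤ s<i))

  desc⇒right : ∀ {i t} → KDesc k w i t → RightCondition i
  desc⇒right {t = t} (i<t , (i-max , _) , t≪i , _) s i<s vi<vs = t , i<t , t≤s , t≪i
    where
    t≤s : toℕ t ≤ toℕ s
    t≤s = ≮⇒≥ λ s<t → <⇒≱ vi<vs (i-max s (<⇒≤ i<s , <⇒≤ s<t))

  asc-extend : ∀ {a i s} → KAsc k w a i → toℕ i < toℕ s → v i < v s →
               (∀ u → toℕ i < toℕ u → toℕ u < toℕ s → v u ≤ v i) →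
               (∀ u → toℕ i < toℕ u → toℕ u ≤ toℕ s → v i < v u + k) →
               KAsc k w a s
  asc-extend {a} {i} {s} (a<i , (a-min , i-max) , a≪i , no-drop) i<s vi<vs gap no-drop′ =
    <-trans a<i i<s , (a-min′ , s-max) , ≤-trans a≪i (<⇒≤ vi<vs) , no-drop″
    where
    below : ∀ u → toℕ a ≤ toℕ u → toℕ u < toℕ s → v u ≤ v i
    below u a≤u u<s with toℕ u ≤? toℕ i
    ... | yes u≤i = i-max u (a≤u , u≤i)
    ... | no u≰i = gap u (≰⇒> u≰i) u<s
    a-min′ : ∀ u → InSec a s u → v a ≤ v u
    a-min′ u (a≤u , u≤s) with toℕ u ≤? toℕ i
    ... | yes u≤i = a-min u (a≤u , u≤i)
    ... | no u≰i = <⇒≤ (+-≤-<-cancelʳ k a≪i (no-drop′ u (≰⇒> u≰i) u≤s))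
    s-max : ∀ u → InSec a s u → v u ≤ v s
    s-max u (a≤u , u≤s) with toℕ u <? toℕ s
    ... | yes u<s = ≤-trans (below u a≤u u<s) (<⇒≤ vi<vs)
    ... | no u≮s = ≤-reflexive (val-≤-antisym u≤s (≮⇒≥ u≮s))
    no-drop″ : ¬ (∃[ p ] ∃[ q ] (InSec a s p × InSec a s q × toℕ p < toℕ q × q ≪ p))
    no-drop″ (p , q , (a≤p , p≤s) , (a≤q , q≤s) , p<q , q≪p) with toℕ q ≤? toℕ i
    ... | yes q≤i = no-drop (p , q , (a≤p , ≤-trans (<⇒≤ p<q) q≤i) , (a≤q , q≤i) , p<q , q≪p)
    ... | no q≰i =
      <⇒≱ (no-drop′ q (≰⇒> q≰i) q≤s) (≤-trans q≪p (below p a≤p (<-≤-trans p<q q≤s)))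

  desc-extend : ∀ {i t s} → KDesc k w i t → toℕ s < toℕ i → v i < v s →
                (∀ u → toℕ s < toℕ u → toℕ u < toℕ i → v u ≤ v i) →
                (∀ u → toℕ s ≤ toℕ u → toℕ u < toℕ i → v i < v u + k) →
                KDesc k w s t
  desc-extend {i} {t} {s} (i<t , (i-max , t-min) , t≪i , no-rise) s<i vi<vs gap no-drop =
    <-trans s<i i<t , (s-max , t-min′) , ≤-trans t≪i (<⇒≤ vi<vs) , no-rise′
    where
    below : ∀ u → toℕ s < toℕ u → toℕ u ≤ toℕ t → v u ≤ v i
    below u s<u u≤t with toℕ i ≤? toℕ u
    ... | yes i≤u = i-max u (i≤u , u≤t)
    ... | no i≰u = gap u s<u (≰⇒> i≰u)
    s-max : ∀ u → InSec s t u → v u ≤ v s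
    s-max u (s≤u , u≤t) with toℕ s <? toℕ u
    ... | yes s<u = ≤-trans (below u s<u u≤t) (<⇒≤ vi<vs)
    ... | no s≮u = ≤-reflexive (val-≤-antisym (≮⇒≥ s≮u) s≤u)
    t-min′ : ∀ u → InSec s t u → v t ≤ v u
    t-min′ u (s≤u , u≤t) with toℕ i ≤? toℕ u
    ... | yes i≤u = t-min u (i≤u , u≤t)
    ... | no i≰u = <⇒≤ (+-≤-<-cancelʳ k t≪i (no-drop u s≤u (≰⇒> i≰u)))
    no-rise′ : ¬ (∃[ p ] ∃[ q ] (InSec s t p × InSec s t q × toℕ p < toℕ q × p ≪ q))
    no-rise′ (p , q , (s≤p , p≤t) , (s≤q , q≤t) , p<q , p≪q) with toℕ i ≤? toℕ p
    ... | yes i≤p = no-rise (p , q , (i≤p , p≤t) , (≤-trans i≤p (<⇒≤ p<q) , q≤t) , p<q , p≪q)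
    ... | no i≰p =
      <⇒≱ (no-drop p s≤p (≰⇒> i≰p)) (≤-trans p≪q (below q (≤-<-trans s≤p p<q) q≤t))

  maxAsc⇒right : ∀ {a i} → MaxKAsc k w a i → RightCondition i
  maxAsc⇒right {a} {i} (asc , maximal) s i<s vi<vs
    with least (λ u → (toℕ i <? toℕ u) ×-dec (v i <? v u)) (s , i<s , vi<vs)
  ... | s′ , (i<s′ , vi<vs′) , s′-first
    with any? (λ j → (toℕ i <? toℕ j) ×-dec (toℕ j ≤? toℕ s′) ×-dec (v j + k ≤? v i))
  ... | yes (j , i<j , j≤s′ , j≪i) = j , i<j , ≤-trans j≤s′ (s′-first s (i<s , vi<vs)) , j≪i
  ... | no none = contradiction (proj₂ (maximal a s′ asc′ ≤-refl (<⇒≤ i<s′))) (<⇒≢ i<s′ ∘ sym)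
    where
    gap : ∀ u → toℕ i < toℕ u → toℕ u < toℕ s′ → v u ≤ v i
    gap u i<u u<s′ = ≮⇒≥ λ vi<vu → <⇒≱ u<s′ (s′-first u (i<u , vi<vu))
    no-drop : ∀ u → toℕ i < toℕ u → toℕ u ≤ toℕ s′ → v i < v u + k
    no-drop u i<u u≤s′ = ≰⇒> λ u≪i → none (u , i<u , u≤s′ , u≪i)
    asc′ : KAsc k w a s′
    asc′ = asc-extend asc i<s′ vi<vs′ gap no-drop

  maxDesc⇒left : ∀ {i t} → MaxKDesc k w i t → LeftCondition i
  maxDesc⇒left {i} {t} (desc , maximal) s s<i vi<vs
    with greatest (λ u → (toℕ u <? toℕ i) ×-dec (v i <? v u)) (s , s<i , vi<vs)
  ... | s′ , (s′<i , vi<vs′) , s′-last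
    with any? (λ j → (toℕ s′ ≤? toℕ j) ×-dec (toℕ j <? toℕ i) ×-dec (v j + k ≤? v i))
  ... | yes (j , s′≤j , j<i , j≪i) = j , ≤-trans (s′-last s (s<i , vi<vs)) s′≤j , j<i , j≪i
  ... | no none = contradiction (proj₁ (maximal s′ t desc′ (<⇒≤ s′<i) ≤-refl)) (<⇒≢ s′<i)
    where
    gap : ∀ u → toℕ s′ < toℕ u → toℕ u < toℕ i → v u ≤ v i
    gap u s′<u u<i = ≮⇒≥ λ vi<vu → <⇒≱ s′<u (s′-last u (u<i , vi<vu))
    no-drop : ∀ u → toℕ s′ ≤ toℕ u → toℕ u < toℕ i → v i < v u + k
    no-drop u s′≤u u<i = ≰⇒> λ u≪i → none (u , s′≤u , u<i , u≪i)
    desc′ : KDesc k w s′ t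
    desc′ = desc-extend desc s′<i vi<vs′ gap no-drop

  peak⇒conditions : ∀ {i} → IsKPeak k w i → RightCondition i × LeftCondition i
  peak⇒conditions (inj₁ (_ , max)) = maxAsc⇒right max , asc⇒left (proj₁ max)
  peak⇒conditions (inj₂ (_ , max)) = desc⇒right (proj₁ max) , maxDesc⇒left max

  lastDrop⇒asc : ∀ {i j} → LeftCondition i → toℕ j < toℕ i → j ≪ i →
                 (∀ u → toℕ j < toℕ u → toℕ u < toℕ i → v i < v u + k) → KAsc k w j i
  lastDrop⇒asc {i} {j} left j<i j≪i no-drop = j<i , (j-min , i-max) , j≪i , no-drop′
    where
    between : ∀ u → toℕ j < toℕ u → toℕ u < toℕ i → v u ≤ v i
    between u j<u u<i = ≮⇒≥ λ vi<vu →
      let (e , u≤e , e<i , e≪i) = left u u<i vi<vu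
      in <⇒≱ (no-drop e (<-≤-trans j<u u≤e) e<i) e≪i
    i-max : ∀ u → InSec j i u → v u ≤ v i
    i-max u (j≤u , u≤i) with toℕ j <? toℕ u | toℕ u <? toℕ i
    ... | yes j<u | yes u<i = between u j<u u<i
    ... | _       | no u≮i  = ≤-reflexive (val-≤-antisym u≤i (≮⇒≥ u≮i))
    ... | no j≮u  | _       =
      subst (_≤ v i) (val-≤-antisym j≤u (≮⇒≥ j≮u)) (≤-trans (m≤m+n (v j) k) j≪i)
    within : ∀ u → InSec j i u → toℕ j < toℕ u → v i < v u + k
    within u (_ , u≤i) j<u with toℕ u <? toℕ i
    ... | yes u<i = no-drop u j<u u<i
    ... | no u≮i = subst (λ x → v i < x + k) (val-≤-antisym (≮⇒≥ u≮i) u≤i) (m<m+n (v i) 1≤k)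
    j-min : ∀ u → InSec j i u → v j ≤ v u
    j-min u u∈@(j≤u , _) with toℕ j <? toℕ u
    ... | yes j<u = <⇒≤ (+-≤-<-cancelʳ k j≪i (within u u∈ j<u))
    ... | no j≮u = ≤-reflexive (val-≤-antisym j≤u (≮⇒≥ j≮u))
    no-drop′ : ¬ (∃[ p ] ∃[ q ] (InSec j i p × InSec j i q × toℕ p < toℕ q × q ≪ p))
    no-drop′ (p , q , p∈ , q∈ , p<q , q≪p) =
      <⇒≱ (within q q∈ (≤-<-trans (proj₁ p∈) p<q)) (≤-trans q≪p (i-max p p∈))

  firstDrop⇒desc : ∀ {i j} → RightCondition i → toℕ i < toℕ j → j ≪ i →
                   (∀ u → toℕ i < toℕ u → toℕ u < toℕ j → v i < v u + k) → KDesc k w i j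
  firstDrop⇒desc {i} {j} right i<j j≪i no-drop = i<j , (i-max , j-min) , j≪i , no-rise
    where
    between : ∀ u → toℕ i < toℕ u → toℕ u < toℕ j → v u ≤ v i
    between u i<u u<j = ≮⇒≥ λ vi<vu →
      let (e , i<e , e≤u , e≪i) = right u i<u vi<vu
      in <⇒≱ (no-drop e i<e (≤-<-trans e≤u u<j)) e≪i
    i-max : ∀ u → InSec i j u → v u ≤ v i
    i-max u (i≤u , u≤j) with toℕ i <? toℕ u | toℕ u <? toℕ j
    ... | yes i<u | yes u<j = between u i<u u<j
    ... | no i≮u  | _       = ≤-reflexive (val-≤-antisym (≮⇒≥ i≮u) i≤u)
    ... | _       | no u≮j  =
      subst (_≤ v i) (val-≤-antisym (≮⇒≥ u≮j) u≤j) (≤-trans (m≤m+n (v j) k) j≪i)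
    within : ∀ u → InSec i j u → toℕ u < toℕ j → v i < v u + k
    within u (i≤u , _) u<j with toℕ i <? toℕ u
    ... | yes i<u = no-drop u i<u u<j
    ... | no i≮u = subst (λ x → v i < x + k) (val-≤-antisym i≤u (≮⇒≥ i≮u)) (m<m+n (v i) 1≤k)
    j-min : ∀ u → InSec i j u → v j ≤ v u
    j-min u u∈@(_ , u≤j) with toℕ u <? toℕ j
    ... | yes u<j = <⇒≤ (+-≤-<-cancelʳ k j≪i (within u u∈ u<j))
    ... | no u≮j = ≤-reflexive (val-≤-antisym (≮⇒≥ u≮j) u≤j)
    no-rise : ¬ (∃[ p ] ∃[ q ] (InSec i j p × InSec i j q × toℕ p < toℕ q × p ≪ q))
    no-rise (p , q , p∈ , q∈ , p<q , p≪q) =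
      <⇒≱ (within p p∈ (<-≤-trans p<q (proj₂ q∈))) (≤-trans p≪q (i-max q q∈))

  right⇒asc-stops : ∀ {i i′ j′} → RightCondition i → KAsc k w i′ j′ → InSec i′ j′ i →
                    toℕ j′ ≤ toℕ i
  right⇒asc-stops {i} right (_ , (_ , j′-max) , _ , no-drop) i∈@(i′≤i , _) = ≮⇒≥ λ i<j′ →
    let (e , i<e , e≤j′ , e≪i) = right _ i<j′ (val-≤∧≢⇒< (<⇒≢ i<j′) (j′-max i i∈))
    in no-drop (i , e , i∈ , (≤-trans i′≤i (<⇒≤ i<e) , e≤j′) , i<e , e≪i)

  left⇒desc-stops : ∀ {i i′ j′} → LeftCondition i → KDesc k w i′ j′ → InSec i′ j′ i →
                    toℕ i ≤ toℕ i′
  left⇒desc-stops {i} left (_ , (i′-max , _) , _ , no-rise) i∈@(_ , i≤j′) = ≮⇒≥ λ i′<i →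
    let (e , i′≤e , e<i , e≪i) = left _ i′<i (val-≤∧≢⇒< (<⇒≢ i′<i ∘ sym) (i′-max i i∈))
    in no-rise (e , i , (i′≤e , ≤-trans (<⇒≤ e<i) i≤j′) , i∈ , e<i , e≪i)

  leftmostAsc⇒maxAsc : ∀ {a i} → RightCondition i → KAsc k w a i →
                       (∀ u → KAsc k w u i → toℕ a ≤ toℕ u) → MaxKAsc k w a i
  leftmostAsc⇒maxAsc right asc leftmost = asc , λ i′ j′ asc′ i′≤a i≤j′ →
    let i∈ = ≤-trans i′≤a (<⇒≤ (proj₁ asc)) , i≤j′
        j′≡i = ≤-antisym (right⇒asc-stops right asc′ i∈) i≤j′
    in ≤-antisym i′≤a (leftmost i′ (subst (KAsc k w i′) (toℕ-injective j′≡i) asc′)) , j′≡i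

  rightmostDesc⇒maxDesc : ∀ {i t} → LeftCondition i → KDesc k w i t →
                          (∀ u → KDesc k w i u → toℕ u ≤ toℕ t) → MaxKDesc k w i t
  rightmostDesc⇒maxDesc left desc rightmost = desc , λ i′ j′ desc′ i′≤i t≤j′ →
    let i∈ = i′≤i , ≤-trans (<⇒≤ (proj₁ desc)) t≤j′
        i′≡i = ≤-antisym i′≤i (left⇒desc-stops left desc′ i∈)
    in i′≡i , ≤-antisym (rightmost j′ (subst (λ x → KDesc k w x j′) (toℕ-injective i′≡i) desc′)) t≤j′

  inSec? : (a b s : Fin n) → Dec (InSec a b s)
  inSec? a b s = (toℕ a ≤? toℕ s) ×-dec (toℕ s ≤? toℕ b)

  kAsc? : ∀ a b → Dec (KAsc k w a b)
  kAsc? a b = (toℕ a <? toℕ b)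
    ×-dec ((all? λ s → inSec? a b s →-dec (v a ≤? v s))
           ×-dec (all? λ s → inSec? a b s →-dec (v s ≤? v b)))
    ×-dec (v a + k ≤? v b)
    ×-dec ¬? (any? λ s → any? λ t →
                inSec? a b s ×-dec inSec? a b t ×-dec (toℕ s <? toℕ t) ×-dec (v t + k ≤? v s))

  kDesc? : ∀ a b → Dec (KDesc k w a b)
  kDesc? a b = (toℕ a <? toℕ b)
    ×-dec ((all? λ s → inSec? a b s →-dec (v s ≤? v a))
           ×-dec (all? λ s → inSec? a b s →-dec (v b ≤? v s)))
    ×-dec (v b + k ≤? v a)
    ×-dec ¬? (any? λ s → any? λ t →
                inSec? a b s ×-dec inSec? a b t ×-dec (toℕ s <? toℕ t) ×-dec (v s + k ≤? v t))

  dropBefore⇒maxAsc : ∀ {i} → RightCondition i → LeftCondition i →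
                      ∃[ j ] (toℕ j < toℕ i × j ≪ i) → ∃[ a ] MaxKAsc k w a i
  dropBefore⇒maxAsc {i} right left drop
    with greatest (λ j → (toℕ j <? toℕ i) ×-dec (v j + k ≤? v i)) drop
  ... | j , (j<i , j≪i) , j-last
    with least (λ a → kAsc? a i) (j , lastDrop⇒asc left j<i j≪i no-drop)
    where
    no-drop : ∀ u → toℕ j < toℕ u → toℕ u < toℕ i → v i < v u + k
    no-drop u j<u u<i = ≰⇒> λ u≪i → <⇒≱ j<u (j-last u (u<i , u≪i))
  ... | a , asc , leftmost = a , leftmostAsc⇒maxAsc right asc leftmost

  dropAfter⇒maxDesc : ∀ {i} → RightCondition i → LeftCondition i →
                      ∃[ j ] (toℕ i < toℕ j × j ≪ i) → ∃[ t ] MaxKDesc k w i t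
  dropAfter⇒maxDesc {i} right left drop
    with least (λ j → (toℕ i <? toℕ j) ×-dec (v j + k ≤? v i)) drop
  ... | j , (i<j , j≪i) , j-first
    with greatest (λ t → kDesc? i t) (j , firstDrop⇒desc right i<j j≪i no-drop)
    where
    no-drop : ∀ u → toℕ i < toℕ u → toℕ u < toℕ j → v i < v u + k
    no-drop u i<u u<j = ≰⇒> λ u≪i → <⇒≱ u<j (j-first u (i<u , u≪i))
  ... | t , desc , rightmost = t , rightmostDesc⇒maxDesc left desc rightmost

  conditions⇒peak : ∀ {i} → RightCondition i → LeftCondition i → ∃[ d ] d ≪ i → IsKPeak k w i
  conditions⇒peak {i} right left (d , d≪i) with any? (λ j → (toℕ j <? toℕ i) ×-dec (v j + k ≤? v i))
  ... | yes drop = inj₁ (dropBefore⇒maxAsc right left drop)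
  ... | no none = inj₂ (dropAfter⇒maxDesc right left (d , i<d , d≪i))
    where
    i<d : toℕ i < toℕ d
    i<d = ≤∧≢⇒< (≮⇒≥ λ d<i → none (d , d<i , d≪i))
                (λ i≡d → ≪-irreflexive (subst (_≪ i) (toℕ-injective (sym i≡d)) d≪i))

  higher⇒drop : ∀ {i s} → RightCondition i → LeftCondition i → v i < v s → ∃[ d ] d ≪ i
  higher⇒drop {i} {s} right left vi<vs with <-cmp (toℕ i) (toℕ s)
  ... | tri< i<s _ _ = let (j , _ , _ , j≪i) = right s i<s vi<vs in j , j≪i
  ... | tri≈ _ i≡s _ = contradiction (cong v (toℕ-injective i≡s)) (<⇒≢ vi<vs)
  ... | tri> _ _ s<i = let (j , _ , _ , j≪i) = left s s<i vi<vs in j , j≪i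

  exists-drop : ∀ {i} → k < n → RightCondition i → LeftCondition i → ∃[ d ] d ≪ i
  exists-drop {i} k<n right left with k ≤? v i
  ... | yes k≤vi = position-of 0 0<n , subst (λ x → x + k ≤ v i) (sym (val-position-of 0 0<n)) k≤vi
    where
    0<n : 0 < n
    0<n = ≤-<-trans z≤n k<n
  ... | no k≰vi = higher⇒drop right left (subst (v i <_) (sym (val-position-of k k<n)) (≰⇒> k≰vi))

proposition3p1 : (n : ℕ) → 2 ≤ n → (w : Permutation′ n) → (i : Fin n) → (k : ℕ) → 1 ≤ k → k + 1 ≤ n →
    IsKPeak k w i ⇔
      ((∀ s → toℕ i < toℕ s → val w i < val w s →
          ∃[ j ] (toℕ i < toℕ j × toℕ j ≤ toℕ s × val w j + k ≤ val w i)) ×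
       (∀ s → toℕ s < toℕ i → val w i < val w s →
          ∃[ j ] (toℕ s ≤ toℕ j × toℕ j < toℕ i × val w j + k ≤ val w i)))
proposition3p1 n _ w i k 1≤k k+1≤n =
  mk⇔ peak⇒conditions λ (right , left) → conditions⇒peak right left (exists-drop k<n right left)
  where
  open KPeaks w k 1≤k
  k<n : k < n
  k<n = subst (_≤ n) (+-comm k 1) k+1≤n
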